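{- For every positive integer $k$, as formal power series in $q$ (equivalently for $|q|<1$), \[ \sum_{n=1}^{\infty}\overline{\mathrm{spt}}k(n)\,q^n=\overline{P}_k(q)\,\frac{(-q^2;q)_{\infty}}{(q^2;q)_{\infty}}+(-1)^k\frac{(q;q)_{k-1}}{(-q;q)_{k}}, \] where the rational functions $\overline{P}_k(q)$ are defined by $\overline{P}_1(q)=1$ and, for $k>1$, \[ \overline{P}_k(q)=\frac{(q^{k-1}-1)\overline{P}_{k-1}(q)+q^{k-1}(1+q)}{1+q^k}. \]
   Context: Notation: $(a;q)_N=\prod_{j=0}^{N-1}(1-aq^j)$ (with $(a;q)_0=1$) and $(a;q)_\infty=\prod_{j\ge 0}(1-aq^j)$. An overpartition of $n$ is a partition of $n$ in which the first occurrence of each distinct part size may (optionally) be overlined. For an overpartition $\pi$, let $s(\pi)$ denote its smallest non-overlined part. For a positive integer $k$, $\overline{\mathrm{spt}}k(n)$ is the number of overpartitions $\pi$ of $n$ that have at least one non-overlined part, whose smallest non-overlined part $s(\pi)$ appears exactly $k$ times, and in which every overlined part is strictly bigger than $s(\pi)$. (Equivalently, $\sum_{n\ge1}\overline{\mathrm{spt}}k(n)q^n=\sum_{n\ge1}q^{kn}\frac{(-q^{n+1};q)_\infty}{(q^{n+1};q)_\infty}$.) -}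

module Defs where

open import Data.Nat as ℕ using (ℕ; zero; suc; _∸_; _≡ᵇ_)
open import Data.Integer as ℤ using (ℤ; +_; -_; _+_; _*_; _-_)
open import Data.Bool using (Bool; true; false; if_then_else_; _∧_)
open import Data.Product using (_×_; _,_)
open import Data.List using (List; []; _∷_; _++_; map; length; upTo; cartesianProduct; filterᵇ; concatMap)

-- An overpartition of n all of whose parts are ≤ n is encoded by a list
-- of length n whose (j-1)-th entry (a , b) describes part size j:
--   a : ℕ     = number of NON-overlined copies of j,
--   b : Bool  = whether an overlined copy of j occurs (at most one,
--               namely the overlined first occurrence).
-- This is a bijection between overpartitions of n and such lists of
-- length n with a ≤ n and weight n.

allLists : ℕ → ℕ → List (List (ℕ × Bool))
allLists m zero      = [] ∷ []
allLists m (suc len) =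
  concatMap (λ e → map (e ∷_) (allLists m len))
            (cartesianProduct (upTo (suc m)) (true ∷ false ∷ []))

bit : Bool → ℕ
bit true  = 1
bit false = 0

weightFrom : ℕ → List (ℕ × Bool) → ℕ
weightFrom j []             = 0
weightFrom j ((a , b) ∷ xs) = j ℕ.* (a ℕ.+ bit b) ℕ.+ weightFrom (suc j) xs

weight : List (ℕ × Bool) → ℕ
weight = weightFrom 1

-- The first size with a
-- non-overlined copy is s(π); we require: such an s exists, it has exactly
-- k non-overlined copies, and every overlined part is strictly bigger
-- than s (i.e. no overlined part of size ≤ s).
sptCond : ℕ → List (ℕ × Bool) → Bool
sptCond k []                    = false
sptCond k ((zero  , true)  ∷ xs) = false
sptCond k ((zero  , false) ∷ xs) = sptCond k xs
sptCond k ((suc a , true)  ∷ xs) = false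
sptCond k ((suc a , false) ∷ xs) = suc a ≡ᵇ k

sptBar : ℕ → ℕ → ℕ
sptBar k n = length (filterᵇ (λ v → (weight v ≡ᵇ n) ∧ sptCond k v) (allLists n n))

Series : Set
Series = ℕ → ℤ

sumBelow : ℕ → (ℕ → ℤ) → ℤ
sumBelow zero    f = + 0
sumBelow (suc n) f = sumBelow n f + f n

oneS : Series
oneS zero    = + 1
oneS (suc n) = + 0

qPow : ℕ → Series
qPow m n = if m ≡ᵇ n then + 1 else + 0

_⊕_ : Series → Series → Series
(f ⊕ g) n = f n + g n

_⊖_ : Series → Series → Series
(f ⊖ g) n = f n - g n

scale : ℤ → Series → Series
scale c f n = c * f n

_⊗_ : Series → Series → Series
(f ⊗ g) n = sumBelow (suc n) (λ i → f i * g (n ∸ i))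

infixl 6 _⊕_ _⊖_
infixl 7 _⊗_

nth : List ℤ → ℕ → ℤ
nth []       _       = + 0
nth (x ∷ xs) zero    = x
nth (x ∷ xs) (suc i) = nth xs i

invCoeffs : Series → ℕ → List ℤ
invCoeffs f zero    = + 1 ∷ []
invCoeffs f (suc m) =
  let L = invCoeffs f m in
  L ++ (- sumBelow (suc m) (λ i → f (suc i) * nth L (m ∸ i)) ∷ [])

-- multiplicative inverse 1/f of a series f with constant term 1
inv : Series → Series
inv f n = nth (invCoeffs f n) n

_⊘_ : Series → Series → Series
f ⊘ g = f ⊗ inv g

-- finite q-Pochhammer (c q^e ; q)_N = Π_{j<N} (1 - c q^{e+j})
poch : ℤ → ℕ → ℕ → Series
poch c e zero    = oneS
poch c e (suc N) = poch c e N ⊗ (oneS ⊖ scale c (qPow (e ℕ.+ N)))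

-- infinite q-Pochhammer (c q^e ; q)_∞ for e ≥ 1: its n-th coefficient
-- equals that of the finite product with N = n+1 (later factors are
-- 1 + O(q^{n+1})).
pochInf : ℤ → ℕ → Series
pochInf c e n = poch c e (suc n) n

signPow : ℕ → ℤ
signPow zero    = + 1
signPow (suc k) = - signPow k

-- the rational functions P̄_k(q) (expanded as power series), k ≥ 1.
-- Index 0 is unused (set to 0).
Pbar : ℕ → Series
Pbar zero          = λ _ → + 0
Pbar (suc zero)    = oneS
Pbar (suc (suc k)) =
  ((qPow (suc k) ⊖ oneS) ⊗ Pbar (suc k) ⊕ qPow (suc k) ⊗ (oneS ⊕ qPow 1))
    ⊘ (oneS ⊕ qPow (suc (suc k)))

sptSeries : ℕ → Series
sptSeries k zero    = + 0
sptSeries k (suc n) = + sptBar k (suc n)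

rhsSeries : ℕ → Series
rhsSeries k =
  Pbar k ⊗ (pochInf (- + 1) 2 ⊘ pochInf (+ 1) 2)
  ⊕ scale (signPow k) (poch (+ 1) 1 (k ∸ 1) ⊘ poch (- + 1) 1 k)

-- Let B e = (-q^e;q)_∞/(q^e;q)_∞ be the generating function of overpartitions
-- into parts ≥ e, so that B e (1 - q^e) = B (e + 1) (1 + q^e).  Sorting the
-- overpartitions counted by spt̄k(n) by their smallest non-overlined part s
-- shows that the left-hand side is S k = Σ_{s ≥ 1} q^(ks) B (s + 1).  Summing
-- q^(ks) B (s + 1) (1 + q^s) = q^(ks) B s (1 - q^s) over s gives
--   S k + S (k + 1) = q^k (B 1 + S k) - q^(k+1) (B 1 + S (k + 1)),
-- and the same sum for k = 0 telescopes to B 1 - 1 = S 1 + q (B 1 + S 1).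
-- With B 1 (1 - q) = B 2 (1 + q) this yields
--   (1 + q) S 1 = (1 + q) B 2 - 1,
--   (1 + q^(k+1)) S (k + 1) = (q^k - 1) S k + q^k (1 + q) B 2.
-- The right-hand side satisfies the same recurrence, by the definition of P̄_k
-- and because c k = (q;q)_{k-1}/(-q;q)_k has c (k + 1) (1 + q^(k+1)) = c k (1 - q^k).
-- As 1 + q^(k+1) is invertible, the recurrence has only one solution.
-- Series are coefficient sequences, so the infinite sums over s are replaced
-- by finite truncations that are exact up to the degree considered.

module Submission where

open import Defs
open import Data.Nat as ℕ using (ℕ; zero; suc; _∸_; _≡ᵇ_; _≤_; _<_; z≤n; s≤s)
import Data.Nat.Properties as ℕₚ
open import Data.Integer as ℤ using (ℤ; +_; -_; _+_; _*_; _-_)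
import Data.Integer.Properties as ℤₚ
open import Data.Product using (_,_)
open import Data.Sum using (inj₁; inj₂; [_,_]′)
open import Data.Maybe using (Maybe; just; nothing)
open import Function using (_∘_)
open import Relation.Nullary using (yes; no)
open import Relation.Binary.PropositionalEquality using (_≡_; _≢_; refl; sym; trans; cong; cong₂; subst; module ≡-Reasoning)
open import Algebra.Bundles using (CommutativeRing)
open import Relation.Binary.Bundles using (Setoid)
open import Algebra.Structures using (IsCommutativeRing)
open import Algebra.Properties.CommutativeSemigroup ℤₚ.+-commutativeSemigroup using (interchange)
import Algebra.Solver.Ring.AlmostCommutativeRing as ACR
import Algebra.Solver.Ring
import Relation.Binary.Reasoning.Setoid as SetoidReasoning
open import Data.List using (List; []; _∷_; _++_; length; map; filterᵇ; concatMap; cartesianProduct; applyUpTo)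
open import Data.List.Properties using (length-++; filter-++)
open import Data.Bool using (Bool; true; false; _∧_; if_then_else_)
open import Data.Bool.Properties using (∧-zeroʳ; ∧-comm)
open import Relation.Nullary.Decidable using (T?; dec-true; dec-false)

sumBelow-cong : ∀ n {f g : ℕ → ℤ} → (∀ i → i < n → f i ≡ g i) → sumBelow n f ≡ sumBelow n g
sumBelow-cong zero    eq = refl
sumBelow-cong (suc n) eq = cong₂ _+_ (sumBelow-cong n (λ i i<n → eq i (ℕₚ.m<n⇒m<1+n i<n))) (eq n ℕₚ.≤-refl)

sumBelow-zero : ∀ n {f : ℕ → ℤ} → (∀ i → i < n → f i ≡ + 0) → sumBelow n f ≡ + 0
sumBelow-zero n eq = trans (sumBelow-cong n eq) (zeros n)
  where
  zeros : ∀ n → sumBelow n (λ _ → + 0) ≡ + 0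
  zeros zero    = refl
  zeros (suc n) = cong (_+ + 0) (zeros n)

sumBelow-+ : ∀ n (f g : ℕ → ℤ) → sumBelow n (λ i → f i + g i) ≡ sumBelow n f + sumBelow n g
sumBelow-+ zero    f g = refl
sumBelow-+ (suc n) f g =
  trans (cong (_+ (f n + g n)) (sumBelow-+ n f g)) (interchange (sumBelow n f) (sumBelow n g) (f n) (g n))

sumBelow-neg : ∀ n (f : ℕ → ℤ) → sumBelow n (λ i → - f i) ≡ - sumBelow n f
sumBelow-neg zero    f = refl
sumBelow-neg (suc n) f = trans (cong (_+ - f n) (sumBelow-neg n f)) (sym (ℤₚ.neg-distrib-+ (sumBelow n f) (f n)))

sumBelow-*ˡ : ∀ n c (f : ℕ → ℤ) → sumBelow n (λ i → c * f i) ≡ c * sumBelow n f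
sumBelow-*ˡ zero    c f = sym (ℤₚ.*-zeroʳ c)
sumBelow-*ˡ (suc n) c f = trans (cong (_+ c * f n) (sumBelow-*ˡ n c f)) (sym (ℤₚ.*-distribˡ-+ c (sumBelow n f) (f n)))

sumBelow-suc : ∀ n (f : ℕ → ℤ) → sumBelow (suc n) f ≡ f 0 + sumBelow n (f ∘ suc)
sumBelow-suc zero    f = ℤₚ.+-comm (+ 0) (f 0)
sumBelow-suc (suc n) f = trans (cong (_+ f (suc n)) (sumBelow-suc n f)) (ℤₚ.+-assoc (f 0) _ _)

sumBelow-reverse : ∀ n (f : ℕ → ℤ) → sumBelow (suc n) f ≡ sumBelow (suc n) (λ i → f (n ∸ i))
sumBelow-reverse zero    f = refl
sumBelow-reverse (suc n) f = begin
  sumBelow (suc n) f + f (suc n)                  ≡⟨ cong (_+ f (suc n)) (sumBelow-reverse n f) ⟩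
  sumBelow (suc n) (λ i → f (n ∸ i)) + f (suc n)  ≡⟨ ℤₚ.+-comm _ (f (suc n)) ⟩
  f (suc n) + sumBelow (suc n) (λ i → f (n ∸ i))  ≡⟨ sym (sumBelow-suc (suc n) (λ i → f (suc n ∸ i))) ⟩
  sumBelow (suc (suc n)) (λ i → f (suc n ∸ i))    ∎
  where open ≡-Reasoning

sumBelow-vanishing : ∀ {m n} (f : ℕ → ℤ) → m ≤ n → (∀ i → m ≤ i → f i ≡ + 0) → sumBelow n f ≡ sumBelow m f
sumBelow-vanishing {n = zero}  f z≤n  _  = refl
sumBelow-vanishing {m} {suc n} f m≤1+n eq with ℕₚ.m≤n⇒m<n∨m≡n m≤1+n
... | inj₂ refl        = refl
... | inj₁ (s≤s m≤n) = begin
  sumBelow n f + f n   ≡⟨ cong₂ _+_ (sumBelow-vanishing f m≤n eq) (eq n m≤n) ⟩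
  sumBelow m f + + 0   ≡⟨ ℤₚ.+-identityʳ _ ⟩
  sumBelow m f         ∎
  where open ≡-Reasoning

-- The ring of formal power series

-- A record rather than a pointwise equation, so that f and g can be
-- recovered from a proof of f ≋ g by unification.
infix 4 _≋_
record _≋_ (f g : Series) : Set where
  constructor mk≋
  field at : ∀ n → f n ≡ g n
open _≋_ public

zeroS : Series
zeroS _ = + 0

negS : Series → Series
negS f n = - f n

tailS : Series → Series
tailS f n = f (suc n)

-- The clause for + 1 makes the ring solver's constant 1 reduce to oneS.
constS : ℤ → Series
constS (+ 1) = oneS
constS c     = scale c oneS

≋-refl : ∀ {f} → f ≋ f
≋-refl = mk≋ (λ _ → refl)

constS-scale : ∀ c → constS c ≋ scale c oneS
constS-scale (+ 1)            = mk≋ λ n → sym (ℤₚ.*-identityˡ (oneS n))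
constS-scale (+ 0)            = ≋-refl
constS-scale (+ suc (suc n))  = ≋-refl
constS-scale (ℤ.-[1+ n ])     = ≋-refl

⊗-zero : ∀ f g → (f ⊗ g) 0 ≡ f 0 * g 0
⊗-zero f g = ℤₚ.+-identityˡ _

⊗-suc : ∀ f g n → (f ⊗ g) (suc n) ≡ f 0 * g (suc n) + (tailS f ⊗ g) n
⊗-suc f g n = sumBelow-suc (suc n) (λ i → f i * g (suc n ∸ i))

⊗-cong : ∀ {f f′ g g′} → f ≋ f′ → g ≋ g′ → f ⊗ g ≋ f′ ⊗ g′
⊗-cong f≋f′ g≋g′ = mk≋ λ n →
  sumBelow-cong (suc n) (λ i _ → cong₂ _*_ (at f≋f′ i) (at g≋g′ (n ∸ i)))

⊗-congˡ : ∀ h {f g} → f ≋ g → h ⊗ f ≋ h ⊗ g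
⊗-congˡ h = ⊗-cong (≋-refl {h})

⊗-congʳ : ∀ h {f g} → f ≋ g → f ⊗ h ≋ g ⊗ h
⊗-congʳ h f≋g = ⊗-cong f≋g (≋-refl {h})

⊗-comm : ∀ f g → f ⊗ g ≋ g ⊗ f
⊗-comm f g = mk≋ λ n → begin
  sumBelow (suc n) (λ i → f i * g (n ∸ i))              ≡⟨ sumBelow-reverse n _ ⟩
  sumBelow (suc n) (λ i → f (n ∸ i) * g (n ∸ (n ∸ i)))  ≡⟨ sumBelow-cong (suc n) (λ i i≤n →
      trans (cong (λ j → f (n ∸ i) * g j) (ℕₚ.m∸[m∸n]≡n (ℕₚ.≤-pred i≤n))) (ℤₚ.*-comm (f (n ∸ i)) (g i))) ⟩
  sumBelow (suc n) (λ i → g i * f (n ∸ i))              ∎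
  where open ≡-Reasoning

⊗-distribʳ : ∀ f g h → (f ⊕ g) ⊗ h ≋ f ⊗ h ⊕ g ⊗ h
⊗-distribʳ f g h = mk≋ λ n →
  trans (sumBelow-cong (suc n) (λ i _ → ℤₚ.*-distribʳ-+ (h (n ∸ i)) (f i) (g i))) (sumBelow-+ (suc n) _ _)

⊗-distribˡ : ∀ f g h → h ⊗ (f ⊕ g) ≋ h ⊗ f ⊕ h ⊗ g
⊗-distribˡ f g h = mk≋ λ n →
  trans (at (⊗-comm h (f ⊕ g)) n) (trans (at (⊗-distribʳ f g h) n) (cong₂ _+_ (at (⊗-comm f h) n) (at (⊗-comm g h) n)))

scale-⊗ : ∀ c f g → scale c f ⊗ g ≋ scale c (f ⊗ g)
scale-⊗ c f g = mk≋ λ n →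
  trans (sumBelow-cong (suc n) (λ i _ → ℤₚ.*-assoc c (f i) (g (n ∸ i)))) (sumBelow-*ˡ (suc n) c _)

scale-cong : ∀ c {f g} → f ≋ g → scale c f ≋ scale c g
scale-cong c f≋g = mk≋ λ n → cong (c *_) (at f≋g n)

scale-neg : ∀ c f → scale (- c) f ≋ negS (scale c f)
scale-neg c f = mk≋ λ n → sym (ℤₚ.neg-distribˡ-* c (f n))

tailS-⊗ : ∀ f g → tailS (f ⊗ g) ≋ scale (f 0) (tailS g) ⊕ tailS f ⊗ g
tailS-⊗ f g = mk≋ (⊗-suc f g)

⊗-identityˡ : ∀ f → oneS ⊗ f ≋ f
⊗-identityˡ f = mk≋ λ where
  zero    → trans (⊗-zero oneS f) (ℤₚ.*-identityˡ (f 0))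
  (suc n) → let open ≡-Reasoning in begin
    (oneS ⊗ f) (suc n)                  ≡⟨ ⊗-suc oneS f n ⟩
    + 1 * f (suc n) + (zeroS ⊗ f) n     ≡⟨ cong₂ _+_ (ℤₚ.*-identityˡ (f (suc n))) (sumBelow-zero (suc n) (λ _ _ → refl)) ⟩
    f (suc n) + + 0                     ≡⟨ ℤₚ.+-identityʳ _ ⟩
    f (suc n)                           ∎

⊗-identityʳ : ∀ f → f ⊗ oneS ≋ f
⊗-identityʳ f = mk≋ λ n → trans (at (⊗-comm f oneS) n) (at (⊗-identityˡ f) n)

private
  ⊗-assoc-at : ∀ f g h n → ((f ⊗ g) ⊗ h) n ≡ (f ⊗ (g ⊗ h)) n
  ⊗-assoc-at f g h zero = let open ≡-Reasoning in begin
    ((f ⊗ g) ⊗ h) 0          ≡⟨ ⊗-zero (f ⊗ g) h ⟩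
    (f ⊗ g) 0 * h 0          ≡⟨ cong (_* h 0) (⊗-zero f g) ⟩
    f 0 * g 0 * h 0          ≡⟨ ℤₚ.*-assoc (f 0) _ _ ⟩
    f 0 * (g 0 * h 0)        ≡⟨ cong (f 0 *_) (sym (⊗-zero g h)) ⟩
    f 0 * (g ⊗ h) 0          ≡⟨ sym (⊗-zero f (g ⊗ h)) ⟩
    (f ⊗ (g ⊗ h)) 0          ∎
  ⊗-assoc-at f g h (suc n) = begin
    ((f ⊗ g) ⊗ h) (suc n)
      ≡⟨ ⊗-suc (f ⊗ g) h n ⟩
    (f ⊗ g) 0 * h (suc n) + (tailS (f ⊗ g) ⊗ h) n
      ≡⟨ cong₂ _+_ (cong (_* h (suc n)) (⊗-zero f g)) (at (⊗-congʳ h (tailS-⊗ f g)) n) ⟩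
    a * b * c + ((scale a (tailS g) ⊕ tailS f ⊗ g) ⊗ h) n
      ≡⟨ cong (_+_ (a * b * c)) (at (⊗-distribʳ (scale a (tailS g)) (tailS f ⊗ g) h) n) ⟩
    a * b * c + ((scale a (tailS g) ⊗ h) n + ((tailS f ⊗ g) ⊗ h) n)
      ≡⟨ cong (_+_ (a * b * c)) (cong₂ _+_ (at (scale-⊗ a (tailS g) h) n) (⊗-assoc-at (tailS f) g h n)) ⟩
    a * b * c + (a * (tailS g ⊗ h) n + (tailS f ⊗ (g ⊗ h)) n)
      ≡⟨ rearrange a b c ((tailS g ⊗ h) n) ((tailS f ⊗ (g ⊗ h)) n) ⟩
    a * (b * c + (tailS g ⊗ h) n) + (tailS f ⊗ (g ⊗ h)) n
      ≡⟨ cong (λ z → a * z + (tailS f ⊗ (g ⊗ h)) n) (sym (⊗-suc g h n)) ⟩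
    a * (g ⊗ h) (suc n) + (tailS f ⊗ (g ⊗ h)) n
      ≡⟨ sym (⊗-suc f (g ⊗ h) n) ⟩
    (f ⊗ (g ⊗ h)) (suc n) ∎
    where
    open ≡-Reasoning
    open import Data.Integer.Solver using (module +-*-Solver)
    open +-*-Solver
    a = f 0
    b = g 0
    c = h (suc n)
    rearrange : ∀ a b c d e → a * b * c + (a * d + e) ≡ a * (b * c + d) + e
    rearrange = solve 5 (λ a b c d e → a :* b :* c :+ (a :* d :+ e) := a :* (b :* c :+ d) :+ e) refl

⊗-assoc : ∀ f g h → (f ⊗ g) ⊗ h ≋ f ⊗ (g ⊗ h)
⊗-assoc f g h = mk≋ (⊗-assoc-at f g h)

⊕-⊗-isCommutativeRing : IsCommutativeRing _≋_ _⊕_ _⊗_ negS zeroS oneS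
⊕-⊗-isCommutativeRing = record
  { isRing = record
    { +-isAbelianGroup = record
      { isGroup = record
        { isMonoid = record
          { isSemigroup = record
            { isMagma = record
              { isEquivalence = record
                { refl  = ≋-refl
                ; sym   = λ p → mk≋ (λ n → sym (at p n))
                ; trans = λ p q → mk≋ (λ n → trans (at p n) (at q n)) }
              ; ∙-cong = λ p q → mk≋ (λ n → cong₂ _+_ (at p n) (at q n)) }
            ; assoc = λ f g h → mk≋ (λ n → ℤₚ.+-assoc (f n) (g n) (h n)) }
          ; identity = (λ f → mk≋ (λ n → ℤₚ.+-identityˡ (f n))) , (λ f → mk≋ (λ n → ℤₚ.+-identityʳ (f n))) }
        ; inverse = (λ f → mk≋ (λ n → ℤₚ.+-inverseˡ (f n))) , (λ f → mk≋ (λ n → ℤₚ.+-inverseʳ (f n)))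
        ; ⁻¹-cong = λ p → mk≋ (λ n → cong -_ (at p n)) }
      ; comm = λ f g → mk≋ (λ n → ℤₚ.+-comm (f n) (g n)) }
    ; *-cong = ⊗-cong
    ; *-assoc = ⊗-assoc
    ; *-identity = ⊗-identityˡ , ⊗-identityʳ
    ; distrib = (λ h f g → ⊗-distribˡ f g h) , (λ h f g → ⊗-distribʳ f g h) }
  ; *-comm = ⊗-comm }

seriesCommutativeRing : CommutativeRing _ _
seriesCommutativeRing = record { isCommutativeRing = ⊕-⊗-isCommutativeRing }

open CommutativeRing seriesCommutativeRing using () renaming
  ( sym to ≋-sym; trans to ≋-trans; setoid to ≋-setoid
  ; +-cong to ⊕-cong; +-assoc to ⊕-assoc; +-comm to ⊕-comm; +-identityˡ to ⊕-identityˡ; +-identityʳ to ⊕-identityʳ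
  ; -‿cong to negS-cong; -‿inverseʳ to ⊖-inverseʳ; zeroʳ to ⊗-zeroʳ )

⊕-congˡ : ∀ h {f g} → f ≋ g → h ⊕ f ≋ h ⊕ g
⊕-congˡ h = ⊕-cong (≋-refl {h})

⊕-congʳ : ∀ h {f g} → f ≋ g → f ⊕ h ≋ g ⊕ h
⊕-congʳ h f≋g = ⊕-cong f≋g (≋-refl {h})

constS-homomorphism : ℤ.+-*-rawRing ACR.-Raw-AlmostCommutative⟶ ACR.fromCommutativeRing seriesCommutativeRing
constS-homomorphism = record
  { ⟦_⟧    = constS
  ; +-homo = λ a b → via-scale (a + b) (⊕-cong (constS-scale a) (constS-scale b))
                       (mk≋ λ n → ℤₚ.*-distribʳ-+ (oneS n) a b)
  ; *-homo = λ a b → via-scale (a * b) (⊗-cong (constS-scale a) (constS-scale b))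
                       (≋-sym (≋-trans (scale-⊗ a oneS (scale b oneS)) (mk≋ λ n →
                         trans (cong (a *_) (at (⊗-identityˡ (scale b oneS)) n)) (sym (ℤₚ.*-assoc a b (oneS n))))))
  ; -‿homo = λ a → via-scale (- a) (negS-cong (constS-scale a)) (mk≋ λ n → sym (ℤₚ.neg-distribˡ-* a (oneS n)))
  ; 0-homo = mk≋ (λ n → ℤₚ.*-zeroˡ (oneS n))
  ; 1-homo = ≋-refl }
  where
  via-scale : ∀ c {f g} → f ≋ g → scale c oneS ≋ g → constS c ≋ f
  via-scale c f≋g c≋g = ≋-trans (constS-scale c) (≋-trans c≋g (≋-sym f≋g))

constS-≟ : ∀ a b → Maybe (constS a ≋ constS b)
constS-≟ a b with a ℤₚ.≟ b
... | yes refl = just ≋-refl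
... | no _     = nothing

module ≋-Reasoning = SetoidReasoning ≋-setoid

open Algebra.Solver.Ring ℤ.+-*-rawRing (ACR.fromCommutativeRing seriesCommutativeRing) constS-homomorphism constS-≟
  using (solve; _:=_; _:+_; _:*_; _:-_; con)

⊖-difference : ∀ z {x y} → x ≋ y → z ⊖ (x ⊖ y) ≋ z
⊖-difference z {x} {y} x≋y = begin
  z ⊖ (x ⊖ y)   ≈⟨ ⊕-congˡ z (negS-cong (⊕-congʳ (negS y) x≋y)) ⟩
  z ⊖ (y ⊖ y)   ≈⟨ solve 2 (λ z y → z :- (y :- y) := z) ≋-refl z y ⟩
  z             ∎
  where open ≋-Reasoning

ΣS : ℕ → (ℕ → Series) → Series
ΣS L F n = sumBelow L (λ s → F s n)

ΣS-cong : ∀ L {F G : ℕ → Series} → (∀ s → F s ≋ G s) → ΣS L F ≋ ΣS L G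
ΣS-cong L F≋G = mk≋ λ n → sumBelow-cong L (λ s _ → at (F≋G s) n)

ΣS-suc : ∀ L (F : ℕ → Series) → ΣS (suc L) F ≋ F 0 ⊕ ΣS L (F ∘ suc)
ΣS-suc L F = mk≋ λ n → sumBelow-suc L (λ s → F s n)

ΣS-⊕ : ∀ L (F G : ℕ → Series) → ΣS L (λ s → F s ⊕ G s) ≋ ΣS L F ⊕ ΣS L G
ΣS-⊕ L F G = mk≋ λ n → sumBelow-+ L (λ s → F s n) (λ s → G s n)

ΣS-⊖ : ∀ L (F G : ℕ → Series) → ΣS L (λ s → F s ⊖ G s) ≋ ΣS L F ⊖ ΣS L G
ΣS-⊖ L F G = mk≋ λ n →
  trans (sumBelow-+ L (λ s → F s n) (λ s → - G s n)) (cong (_+_ (ΣS L F n)) (sumBelow-neg L (λ s → G s n)))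

ΣS-⊗ : ∀ L h (F : ℕ → Series) → h ⊗ ΣS L F ≋ ΣS L (λ s → h ⊗ F s)
ΣS-⊗ zero    h F = ⊗-zeroʳ h
ΣS-⊗ (suc L) h F = ≋-trans (⊗-distribˡ (ΣS L F) (F L) h) (⊕-congʳ (h ⊗ F L) (ΣS-⊗ L h F))

ΣS-telescope : ∀ L (G : ℕ → Series) → ΣS L (λ s → G s ⊖ G (suc s)) ≋ G 0 ⊖ G L
ΣS-telescope zero    G = ≋-sym (⊖-inverseʳ (G 0))
ΣS-telescope (suc L) G = begin
  ΣS L (λ s → G s ⊖ G (suc s)) ⊕ (G L ⊖ G (suc L))   ≈⟨ ⊕-congʳ (G L ⊖ G (suc L)) (ΣS-telescope L G) ⟩
  (G 0 ⊖ G L) ⊕ (G L ⊖ G (suc L))                    ≈⟨ solve 3 (λ a b c → (a :- b) :+ (b :- c) := a :- c) ≋-refl (G 0) (G L) (G (suc L)) ⟩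
  G 0 ⊖ G (suc L)                                    ∎
  where open ≋-Reasoning

infix 4 _≈[<_]_
_≈[<_]_ : Series → ℕ → Series → Set
f ≈[< m ] g = ∀ i → i < m → f i ≡ g i

≈[<]-setoid : ℕ → Setoid _ _
≈[<]-setoid m = record
  { Carrier       = Series
  ; _≈_           = _≈[< m ]_
  ; isEquivalence = record
    { refl  = λ _ _ → refl
    ; sym   = λ f≈g i i<m → sym (f≈g i i<m)
    ; trans = λ f≈g g≈h i i<m → trans (f≈g i i<m) (g≈h i i<m) } }

module ≈[<]-Reasoning (m : ℕ) = SetoidReasoning (≈[<]-setoid m)

≋⇒≈[<] : ∀ {m f g} → f ≋ g → f ≈[< m ] g
≋⇒≈[<] f≋g i _ = at f≋g i

⊕-cong-below : ∀ {m f f′ g g′} → f ≈[< m ] f′ → g ≈[< m ] g′ → f ⊕ g ≈[< m ] f′ ⊕ g′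
⊕-cong-below f≈f′ g≈g′ i i<m = cong₂ _+_ (f≈f′ i i<m) (g≈g′ i i<m)

⊗-cong-below : ∀ {m f f′ g g′} → f ≈[< m ] f′ → g ≈[< m ] g′ → f ⊗ g ≈[< m ] f′ ⊗ g′
⊗-cong-below f≈f′ g≈g′ n n<m = sumBelow-cong (suc n) λ i i≤n →
  cong₂ _*_ (f≈f′ i (ℕₚ.≤-<-trans (ℕₚ.≤-pred i≤n) n<m)) (g≈g′ (n ∸ i) (ℕₚ.≤-<-trans (ℕₚ.m∸n≤m n i) n<m))

⊗-congˡ-below : ∀ {m} h {f g} → f ≈[< m ] g → h ⊗ f ≈[< m ] h ⊗ g
⊗-congˡ-below h = ⊗-cong-below {f = h} (λ _ _ → refl)

⊗-cong-below-oneS : ∀ {m f g h} → f ≈[< m ] g → h ≈[< m ] oneS → f ⊗ h ≈[< m ] g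
⊗-cong-below-oneS {g = g} f≈g h≈1 i i<m = trans (⊗-cong-below f≈g h≈1 i i<m) (at (⊗-identityʳ g) i)

ΣS-cong-below : ∀ {m} L {F G : ℕ → Series} → (∀ s → F s ≈[< m ] G s) → ΣS L F ≈[< m ] ΣS L G
ΣS-cong-below L F≈G i i<m = sumBelow-cong L (λ s _ → F≈G s i i<m)

shift : ℕ → Series → Series
shift zero    f         = f
shift (suc d) f zero    = + 0
shift (suc d) f (suc n) = shift d f n

qPow-zero : qPow 0 ≋ oneS
qPow-zero = mk≋ λ where
  zero    → refl
  (suc n) → refl

qPow-below : ∀ d → qPow d ≈[< d ] zeroS
qPow-below (suc d) zero    _         = refl
qPow-below (suc d) (suc i) (s≤s i<d) = qPow-below d i i<d

qPow-⊗ : ∀ d f → qPow d ⊗ f ≋ shift d f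
qPow-⊗ zero    f = ≋-trans (⊗-congʳ f qPow-zero) (⊗-identityˡ f)
qPow-⊗ (suc d) f = mk≋ λ where
  zero    → trans (⊗-zero (qPow (suc d)) f) (ℤₚ.*-zeroˡ (f 0))
  (suc n) → trans (⊗-suc (qPow (suc d)) f n) (trans (ℤₚ.+-identityˡ _) (at (qPow-⊗ d f) n))

qPow-⊗-below : ∀ d f {n} → n < d → (qPow d ⊗ f) n ≡ + 0
qPow-⊗-below d f {n} n<d = begin
  (qPow d ⊗ f) n   ≡⟨ ⊗-cong-below {g = f} (qPow-below d) (λ _ _ → refl) n n<d ⟩
  (zeroS ⊗ f) n    ≡⟨ sumBelow-zero (suc n) (λ _ _ → refl) ⟩
  + 0              ∎
  where open ≡-Reasoning

qPow-⊗-≈[<]-zero : ∀ {m} d f → m ≤ d → qPow d ⊗ f ≈[< m ] zeroS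
qPow-⊗-≈[<]-zero d f m≤d i i<m = qPow-⊗-below d f (ℕₚ.<-≤-trans i<m m≤d)

qPow-cong : ∀ {a b} → a ≡ b → qPow a ≋ qPow b
qPow-cong a≡b = mk≋ λ n → cong (λ d → qPow d n) a≡b

qPow-+ : ∀ a b → qPow (a ℕ.+ b) ≋ qPow a ⊗ qPow b
qPow-+ a b = ≋-sym (≋-trans (qPow-⊗ a (qPow b)) (shift-qPow a))
  where
  shift-qPow : ∀ a → shift a (qPow b) ≋ qPow (a ℕ.+ b)
  shift-qPow zero    = ≋-refl
  shift-qPow (suc a) = mk≋ λ where
    zero    → refl
    (suc n) → at (shift-qPow a) n

geometric-sum : ∀ j M → (oneS ⊖ qPow j) ⊗ ΣS M (λ a → qPow (j ℕ.* a)) ≋ oneS ⊖ qPow (j ℕ.* M)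
geometric-sum j M = begin
  (oneS ⊖ qPow j) ⊗ ΣS M (λ a → qPow (j ℕ.* a))           ≈⟨ ΣS-⊗ M (oneS ⊖ qPow j) (λ a → qPow (j ℕ.* a)) ⟩
  ΣS M (λ a → (oneS ⊖ qPow j) ⊗ qPow (j ℕ.* a))           ≈⟨ ΣS-cong M term ⟩
  ΣS M (λ a → qPow (j ℕ.* a) ⊖ qPow (j ℕ.* suc a))        ≈⟨ ΣS-telescope M (λ a → qPow (j ℕ.* a)) ⟩
  qPow (j ℕ.* 0) ⊖ qPow (j ℕ.* M)
    ≈⟨ ⊕-congʳ (negS (qPow (j ℕ.* M))) (≋-trans (qPow-cong (ℕₚ.*-zeroʳ j)) qPow-zero) ⟩
  oneS ⊖ qPow (j ℕ.* M)                                   ∎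
  where
  open ≋-Reasoning
  term : ∀ a → (oneS ⊖ qPow j) ⊗ qPow (j ℕ.* a) ≋ qPow (j ℕ.* a) ⊖ qPow (j ℕ.* suc a)
  term a = begin
    (oneS ⊖ qPow j) ⊗ qPow (j ℕ.* a)
      ≈⟨ solve 2 (λ x y → (con (+ 1) :- x) :* y := y :- x :* y) ≋-refl (qPow j) (qPow (j ℕ.* a)) ⟩
    qPow (j ℕ.* a) ⊖ qPow j ⊗ qPow (j ℕ.* a)
      ≈⟨ ⊕-congˡ (qPow (j ℕ.* a)) (negS-cong (≋-sym (≋-trans (qPow-cong (ℕₚ.*-suc j a)) (qPow-+ j (j ℕ.* a))))) ⟩
    qPow (j ℕ.* a) ⊖ qPow (j ℕ.* suc a) ∎

length-invCoeffs : ∀ f m → length (invCoeffs f m) ≡ suc m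
length-invCoeffs f zero    = refl
length-invCoeffs f (suc m) =
  trans (length-++ (invCoeffs f m)) (trans (cong (ℕ._+ 1) (length-invCoeffs f m)) (ℕₚ.+-comm (suc m) 1))

private
  nth-++-< : ∀ (xs : List ℤ) x {i} → i < length xs → nth (xs ++ x ∷ []) i ≡ nth xs i
  nth-++-< (y ∷ xs) x {zero}  _         = refl
  nth-++-< (y ∷ xs) x {suc i} (s≤s i<n) = nth-++-< xs x i<n

  nth-++-length : ∀ (xs : List ℤ) x → nth (xs ++ x ∷ []) (length xs) ≡ x
  nth-++-length []       x = refl
  nth-++-length (y ∷ xs) x = nth-++-length xs x

nth-invCoeffs : ∀ f {m i} → i ≤ m → nth (invCoeffs f m) i ≡ inv f i
nth-invCoeffs f {zero}  z≤n = refl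
nth-invCoeffs f {suc m} i≤1+m with ℕₚ.m≤n⇒m<n∨m≡n i≤1+m
... | inj₂ refl      = refl
... | inj₁ (s≤s i≤m) = trans (nth-++-< (invCoeffs f m) _ (subst (_ <_) (sym (length-invCoeffs f m)) (s≤s i≤m)))
                             (nth-invCoeffs f i≤m)

inv-suc : ∀ f m → inv f (suc m) ≡ - sumBelow (suc m) (λ i → f (suc i) * inv f (m ∸ i))
inv-suc f m = begin
  nth (L ++ x ∷ []) (suc m)           ≡⟨ cong (nth (L ++ x ∷ [])) (sym (length-invCoeffs f m)) ⟩
  nth (L ++ x ∷ []) (length L)        ≡⟨ nth-++-length L x ⟩
  x                                   ≡⟨ cong -_ (sumBelow-cong (suc m) (λ i _ → cong (f (suc i) *_) (nth-invCoeffs f (ℕₚ.m∸n≤m m i)))) ⟩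
  - sumBelow (suc m) (λ i → f (suc i) * inv f (m ∸ i)) ∎
  where
  open ≡-Reasoning
  L = invCoeffs f m
  x = - sumBelow (suc m) (λ i → f (suc i) * nth L (m ∸ i))

⊗-inv : ∀ f → f 0 ≡ + 1 → f ⊗ inv f ≋ oneS
⊗-inv f f₀≡1 = mk≋ λ where
  zero    → trans (⊗-zero f (inv f)) (cong (_* + 1) f₀≡1)
  (suc m) → let open ≡-Reasoning; X = (tailS f ⊗ inv f) m in begin
    (f ⊗ inv f) (suc m)                 ≡⟨ ⊗-suc f (inv f) m ⟩
    f 0 * inv f (suc m) + X             ≡⟨ cong (_+ X) (cong₂ _*_ f₀≡1 (inv-suc f m)) ⟩
    + 1 * (- X) + X                     ≡⟨ cong (_+ X) (ℤₚ.*-identityˡ (- X)) ⟩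
    - X + X                             ≡⟨ ℤₚ.+-inverseˡ X ⟩
    + 0                                 ∎

⊘-⊗ : ∀ f g → g 0 ≡ + 1 → (f ⊘ g) ⊗ g ≋ f
⊘-⊗ f g g₀≡1 = begin
  (f ⊗ inv g) ⊗ g    ≈⟨ ⊗-assoc f (inv g) g ⟩
  f ⊗ (inv g ⊗ g)    ≈⟨ ⊗-congˡ f (≋-trans (⊗-comm (inv g) g) (⊗-inv g g₀≡1)) ⟩
  f ⊗ oneS           ≈⟨ ⊗-identityʳ f ⟩
  f                  ∎
  where open ≋-Reasoning

⊗-⊘ : ∀ f g → g 0 ≡ + 1 → (f ⊗ g) ⊘ g ≋ f
⊗-⊘ f g g₀≡1 = begin
  (f ⊗ g) ⊗ inv g    ≈⟨ ⊗-assoc f g (inv g) ⟩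
  f ⊗ (g ⊗ inv g)    ≈⟨ ⊗-congˡ f (⊗-inv g g₀≡1) ⟩
  f ⊗ oneS           ≈⟨ ⊗-identityʳ f ⟩
  f                  ∎
  where open ≋-Reasoning

⊗-cancelʳ : ∀ u {f g} → u 0 ≡ + 1 → f ⊗ u ≋ g ⊗ u → f ≋ g
⊗-cancelʳ u {f} {g} u₀≡1 fu≋gu = begin
  f                   ≈⟨ ≋-sym (⊗-⊘ f u u₀≡1) ⟩
  (f ⊗ u) ⊘ u         ≈⟨ ⊗-congʳ (inv u) fu≋gu ⟩
  (g ⊗ u) ⊘ u         ≈⟨ ⊗-⊘ g u u₀≡1 ⟩
  g                   ∎
  where open ≋-Reasoning

inv-below : ∀ {m} f → f ≈[< m ] oneS → inv f ≈[< m ] oneS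
inv-below f f≈1 zero    _   = refl
inv-below f f≈1 (suc j) j<m = trans (inv-suc f j) (cong -_ (sumBelow-zero (suc j) λ i i≤j →
  trans (cong (_* inv f (j ∸ i)) (f≈1 (suc i) (ℕₚ.≤-<-trans (s≤s (ℕₚ.≤-pred i≤j)) j<m))) (ℤₚ.*-zeroˡ (inv f (j ∸ i)))))

factor : ℤ → ℕ → Series
factor c d = oneS ⊖ scale c (qPow d)

factor-below : ∀ c d → factor c d ≈[< d ] oneS
factor-below c d i i<d = begin
  oneS i - c * qPow d i   ≡⟨ cong (λ x → oneS i - c * x) (qPow-below d i i<d) ⟩
  oneS i - c * + 0        ≡⟨ cong (λ x → oneS i - x) (ℤₚ.*-zeroʳ c) ⟩
  oneS i - + 0            ≡⟨ ℤₚ.+-identityʳ (oneS i) ⟩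
  oneS i                  ∎
  where open ≡-Reasoning

factor-+1 : ∀ d → factor (+ 1) d ≋ oneS ⊖ qPow d
factor-+1 d = mk≋ λ n → cong (λ x → oneS n - x) (ℤₚ.*-identityˡ (qPow d n))

factor--1 : ∀ d → factor (- + 1) d ≋ oneS ⊕ qPow d
factor--1 d = mk≋ λ n → cong (_+_ (oneS n)) (trans (cong -_ (ℤₚ.-1*i≡-i (qPow d n))) (ℤₚ.neg-involutive (qPow d n)))

poch-below : ∀ c e N → poch c e N ≈[< e ] oneS
poch-below c e zero    = λ _ _ → refl
poch-below c e (suc N) = ⊗-cong-below-oneS (poch-below c e N)
  (λ i i<e → factor-below c (e ℕ.+ N) i (ℕₚ.<-≤-trans i<e (ℕₚ.m≤m+n e N)))

poch-stable : ∀ c e {N N′} → N ℕ.≤′ N′ → poch c e N′ ≈[< e ℕ.+ N ] poch c e N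
poch-stable c e ℕ.≤′-refl                   = λ _ _ → refl
poch-stable c e {N} (ℕ.≤′-step {N′} N≤′N′) = ⊗-cong-below-oneS (poch-stable c e N≤′N′)
  (λ i i<e+N → factor-below c (e ℕ.+ N′) i (ℕₚ.<-≤-trans i<e+N (ℕₚ.+-monoʳ-≤ e (ℕₚ.≤′⇒≤ N≤′N′))))

pochInf-poch : ∀ c e N {i} → i < e ℕ.+ N → pochInf c e i ≡ poch c e N i
pochInf-poch c e N {i} i<e+N with ℕₚ.≤-total (suc i) N
... | inj₁ 1+i≤N = sym (poch-stable c e (ℕₚ.≤⇒≤′ 1+i≤N) i (ℕₚ.m≤n+m (suc i) e))
... | inj₂ N≤1+i = poch-stable c e (ℕₚ.≤⇒≤′ N≤1+i) i i<e+N

poch-suc-left : ∀ c e N → poch c e (suc N) ≋ factor c e ⊗ poch c (suc e) N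
poch-suc-left c e zero    = ≋-trans (⊗-identityˡ _) (≋-trans (mk≋ λ n → cong (λ d → factor c d n) (ℕₚ.+-identityʳ e))
                                                              (≋-sym (⊗-identityʳ (factor c e))))
poch-suc-left c e (suc N) = begin
  poch c e (suc N) ⊗ factor c (e ℕ.+ suc N)
    ≈⟨ ⊗-cong (poch-suc-left c e N) (mk≋ λ n → cong (λ d → factor c d n) (ℕₚ.+-suc e N)) ⟩
  (factor c e ⊗ poch c (suc e) N) ⊗ factor c (suc e ℕ.+ N)
    ≈⟨ ⊗-assoc (factor c e) (poch c (suc e) N) (factor c (suc e ℕ.+ N)) ⟩
  factor c e ⊗ (poch c (suc e) N ⊗ factor c (suc e ℕ.+ N)) ∎
  where open ≋-Reasoning

pochInf-suc : ∀ c e → pochInf c e ≋ factor c e ⊗ pochInf c (suc e)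
pochInf-suc c e = mk≋ λ m → begin
  poch c e (suc m) m                    ≡⟨ at (poch-suc-left c e m) m ⟩
  (factor c e ⊗ poch c (suc e) m) m     ≡⟨ ⊗-congˡ-below (factor c e) agree m ℕₚ.≤-refl ⟩
  (factor c e ⊗ pochInf c (suc e)) m    ∎
  where
  open ≡-Reasoning
  agree : ∀ {m} → poch c (suc e) m ≈[< suc m ] pochInf c (suc e)
  agree {m} i i≤m = sym (pochInf-poch c (suc e) m (s≤s (ℕₚ.≤-trans (ℕₚ.≤-pred i≤m) (ℕₚ.m≤n+m m e))))

pochInf-below : ∀ c e → pochInf c e ≈[< e ] oneS
pochInf-below c e i i<e = poch-below c e (suc i) i i<e

B : ℕ → Series
B e = pochInf (- + 1) e ⊘ pochInf (+ 1) e

B-below : ∀ e → B e ≈[< e ] oneS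
B-below e = ⊗-cong-below-oneS (pochInf-below (- + 1) e) (inv-below (pochInf (+ 1) e) (pochInf-below (+ 1) e))

pochInf-unit : ∀ c e → 1 ≤ e → pochInf c e 0 ≡ + 1
pochInf-unit c e 1≤e = pochInf-below c e 0 1≤e

B-step : ∀ e → 1 ≤ e → B e ⊗ (oneS ⊖ qPow e) ≋ B (suc e) ⊗ (oneS ⊕ qPow e)
B-step e 1≤e = ⊗-cancelʳ C (pochInf-unit (+ 1) e 1≤e) (begin
  (B e ⊗ (oneS ⊖ qPow e)) ⊗ C              ≈⟨ solve 3 (λ b x c → (b :* x) :* c := (b :* c) :* x) ≋-refl (B e) (oneS ⊖ qPow e) C ⟩
  (B e ⊗ C) ⊗ (oneS ⊖ qPow e)              ≈⟨ ⊗-congʳ (oneS ⊖ qPow e) (⊘-⊗ A C (pochInf-unit (+ 1) e 1≤e)) ⟩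
  A ⊗ (oneS ⊖ qPow e)
    ≈⟨ ⊗-congʳ (oneS ⊖ qPow e) (≋-trans (pochInf-suc (- + 1) e) (⊗-cong (factor--1 e) (≋-sym (⊘-⊗ A′ C′ (pochInf-unit (+ 1) (suc e) (s≤s z≤n)))))) ⟩
  ((oneS ⊕ qPow e) ⊗ (B (suc e) ⊗ C′)) ⊗ (oneS ⊖ qPow e)
    ≈⟨ solve 4 (λ p b c m → (p :* (b :* c)) :* m := (b :* p) :* (m :* c)) ≋-refl (oneS ⊕ qPow e) (B (suc e)) C′ (oneS ⊖ qPow e) ⟩
  (B (suc e) ⊗ (oneS ⊕ qPow e)) ⊗ ((oneS ⊖ qPow e) ⊗ C′)
    ≈⟨ ⊗-congˡ (B (suc e) ⊗ (oneS ⊕ qPow e)) (≋-sym (≋-trans (pochInf-suc (+ 1) e) (⊗-congʳ C′ (factor-+1 e)))) ⟩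
  (B (suc e) ⊗ (oneS ⊕ qPow e)) ⊗ C         ∎)
  where
  open ≋-Reasoning
  A  = pochInf (- + 1) e
  A′ = pochInf (- + 1) (suc e)
  C  = pochInf (+ 1) e
  C′ = pochInf (+ 1) (suc e)

poch-unit : ∀ c N → poch c 1 N 0 ≡ + 1
poch-unit c N = poch-below c 1 N 0 (s≤s z≤n)

-- The spt generating function and its recurrence

-- sptGF k = Σ_{s ≥ 1} q^(ks) B (s + 1), its coefficient of q^n computed from the terms
-- with s ≤ n; for k ≥ 1 the other terms do not reach q^n.
sptTerm : ℕ → ℕ → Series
sptTerm k s = qPow (k ℕ.* suc s) ⊗ B (suc (suc s))

sptPartial : ℕ → ℕ → Series
sptPartial k L = ΣS L (sptTerm k)

sptGF : ℕ → Series
sptGF k n = sptPartial k n n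

sptPartial-stable : ∀ k L → sptPartial (suc k) L ≈[< suc L ] sptGF (suc k)
sptPartial-stable k L i (s≤s i≤L) = sumBelow-vanishing (λ s → sptTerm (suc k) s i) i≤L λ s i≤s →
  qPow-⊗-below (suc k ℕ.* suc s) (B (suc (suc s))) (ℕₚ.<-≤-trans (s≤s i≤s) (ℕₚ.m≤n*m (suc s) (suc k)))

private
  U : ℕ → ℕ → Series
  U k s = qPow (k ℕ.* suc s) ⊗ B (suc s)

  sptTerm-pair : ∀ k s → sptTerm k s ⊕ sptTerm (suc k) s ≋ U k s ⊖ U (suc k) s
  sptTerm-pair k s = begin
    Q ⊗ B′ ⊕ qPow (suc s ℕ.+ k ℕ.* suc s) ⊗ B′    ≈⟨ ⊕-congˡ (Q ⊗ B′) (⊗-congʳ B′ (qPow-+ (suc s) (k ℕ.* suc s))) ⟩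
    Q ⊗ B′ ⊕ (x ⊗ Q) ⊗ B′                         ≈⟨ solve 3 (λ Q x B′ → Q :* B′ :+ (x :* Q) :* B′ := Q :* (B′ :* (con (+ 1) :+ x))) ≋-refl Q x B′ ⟩
    Q ⊗ (B′ ⊗ (oneS ⊕ x))                         ≈⟨ ⊗-congˡ Q (≋-sym (B-step (suc s) (s≤s z≤n))) ⟩
    Q ⊗ (B (suc s) ⊗ (oneS ⊖ x))                  ≈⟨ solve 3 (λ Q x B → Q :* (B :* (con (+ 1) :- x)) := Q :* B :- (x :* Q) :* B) ≋-refl Q x (B (suc s)) ⟩
    Q ⊗ B (suc s) ⊖ (x ⊗ Q) ⊗ B (suc s)           ≈⟨ ⊕-congˡ (U k s) (negS-cong (⊗-congʳ (B (suc s)) (≋-sym (qPow-+ (suc s) (k ℕ.* suc s))))) ⟩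
    U k s ⊖ U (suc k) s                           ∎
    where
    open ≋-Reasoning
    Q = qPow (k ℕ.* suc s)
    x = qPow (suc s)
    B′ = B (suc (suc s))

  ΣS-U : ∀ k L → ΣS (suc L) (U k) ≋ qPow k ⊗ (B 1 ⊕ sptPartial k L)
  ΣS-U k L = begin
    ΣS (suc L) (U k)                                   ≈⟨ ΣS-suc L (U k) ⟩
    U k 0 ⊕ ΣS L (U k ∘ suc)                           ≈⟨ ⊕-cong (⊗-congʳ (B 1) (qPow-cong (ℕₚ.*-identityʳ k))) (ΣS-cong L shifted) ⟩
    qPow k ⊗ B 1 ⊕ ΣS L (λ s → qPow k ⊗ sptTerm k s)   ≈⟨ ⊕-congˡ (qPow k ⊗ B 1) (≋-sym (ΣS-⊗ L (qPow k) (sptTerm k))) ⟩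
    qPow k ⊗ B 1 ⊕ qPow k ⊗ sptPartial k L             ≈⟨ ≋-sym (⊗-distribˡ (B 1) (sptPartial k L) (qPow k)) ⟩
    qPow k ⊗ (B 1 ⊕ sptPartial k L)                    ∎
    where
    open ≋-Reasoning
    shifted : ∀ s → U k (suc s) ≋ qPow k ⊗ sptTerm k s
    shifted s = ≋-trans (⊗-congʳ (B (suc (suc s))) (≋-trans (qPow-cong (ℕₚ.*-suc k (suc s))) (qPow-+ k (k ℕ.* suc s))))
                        (⊗-assoc (qPow k) (qPow (k ℕ.* suc s)) (B (suc (suc s))))

sptPartial-recurrence : ∀ k L →
  sptPartial k (suc L) ⊕ sptPartial (suc k) (suc L) ≋ qPow k ⊗ (B 1 ⊕ sptPartial k L) ⊖ qPow (suc k) ⊗ (B 1 ⊕ sptPartial (suc k) L)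
sptPartial-recurrence k L = begin
  sptPartial k (suc L) ⊕ sptPartial (suc k) (suc L)      ≈⟨ ≋-sym (ΣS-⊕ (suc L) (sptTerm k) (sptTerm (suc k))) ⟩
  ΣS (suc L) (λ s → sptTerm k s ⊕ sptTerm (suc k) s)     ≈⟨ ΣS-cong (suc L) (sptTerm-pair k) ⟩
  ΣS (suc L) (λ s → U k s ⊖ U (suc k) s)                 ≈⟨ ΣS-⊖ (suc L) (U k) (U (suc k)) ⟩
  ΣS (suc L) (U k) ⊖ ΣS (suc L) (U (suc k))              ≈⟨ ⊕-cong (ΣS-U k L) (negS-cong (ΣS-U (suc k) L)) ⟩
  qPow k ⊗ (B 1 ⊕ sptPartial k L) ⊖ qPow (suc k) ⊗ (B 1 ⊕ sptPartial (suc k) L) ∎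
  where open ≋-Reasoning

sptGF-step : ∀ k → sptGF (suc k) ⊕ sptGF (2 ℕ.+ k) ≋ qPow (suc k) ⊗ (B 1 ⊕ sptGF (suc k)) ⊖ qPow (2 ℕ.+ k) ⊗ (B 1 ⊕ sptGF (2 ℕ.+ k))
sptGF-step k = mk≋ λ n → begin
  sptGF (suc k) n + sptGF (2 ℕ.+ k) n
    ≡⟨ sym (cong₂ _+_ (sptPartial-stable k (suc n) n (ℕₚ.n≤1+n (suc n))) (sptPartial-stable (suc k) (suc n) n (ℕₚ.n≤1+n (suc n)))) ⟩
  (sptPartial (suc k) (suc n) ⊕ sptPartial (2 ℕ.+ k) (suc n)) n
    ≡⟨ at (sptPartial-recurrence (suc k) n) n ⟩
  (qPow (suc k) ⊗ (B 1 ⊕ sptPartial (suc k) n) ⊖ qPow (2 ℕ.+ k) ⊗ (B 1 ⊕ sptPartial (2 ℕ.+ k) n)) n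
    ≡⟨ cong₂ _-_ (⊗-congˡ-below (qPow (suc k)) (B1⊕-stable k n) n ℕₚ.≤-refl)
                 (⊗-congˡ-below (qPow (2 ℕ.+ k)) (B1⊕-stable (suc k) n) n ℕₚ.≤-refl) ⟩
  (qPow (suc k) ⊗ (B 1 ⊕ sptGF (suc k)) ⊖ qPow (2 ℕ.+ k) ⊗ (B 1 ⊕ sptGF (2 ℕ.+ k))) n ∎
  where
  open ≡-Reasoning
  B1⊕-stable : ∀ k n → B 1 ⊕ sptPartial (suc k) n ≈[< suc n ] B 1 ⊕ sptGF (suc k)
  B1⊕-stable k n i i≤n = cong (_+_ (B 1 i)) (sptPartial-stable k n i i≤n)

sptGF-base : B 1 ⊖ oneS ≋ sptGF 1 ⊕ qPow 1 ⊗ (B 1 ⊕ sptGF 1)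
sptGF-base = mk≋ λ n → let open ≡-Reasoning in begin
  B 1 n - oneS n
    ≡⟨ cong (λ x → B 1 n - x) (sym (B-below (2 ℕ.+ n) n (ℕₚ.n≤1+n (suc n)))) ⟩
  B 1 n - B (2 ℕ.+ n) n
    ≡⟨ cong (λ x → B 1 n - x) (sym (at (≋-trans (⊗-congʳ (B (2 ℕ.+ n)) qPow-zero) (⊗-identityˡ (B (2 ℕ.+ n)))) n)) ⟩
  (B 1 ⊖ sptTerm 0 n) n
    ≡⟨ at (telescoped n) n ⟩
  sptPartial 1 (suc n) n + (qPow 1 ⊗ (B 1 ⊕ sptPartial 1 n)) n
    ≡⟨ cong₂ _+_ (sptPartial-stable 0 (suc n) n (ℕₚ.n≤1+n (suc n)))
                 (⊗-congˡ-below (qPow 1) (λ i i≤n → cong (_+_ (B 1 i)) (sptPartial-stable 0 n i i≤n)) n ℕₚ.≤-refl) ⟩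
  sptGF 1 n + (qPow 1 ⊗ (B 1 ⊕ sptGF 1)) n ∎
  where
  telescoped : ∀ n → B 1 ⊖ sptTerm 0 n ≋ sptPartial 1 (suc n) ⊕ qPow 1 ⊗ (B 1 ⊕ sptPartial 1 n)
  telescoped n = begin
    B 1 ⊖ T
      ≈⟨ solve 5 (λ b t x p r → b :- t := (p :+ r) :- ((x :+ t) :+ p :- (con (+ 1) :* (b :+ x) :- r))) ≋-refl (B 1) T X P R ⟩
    (P ⊕ R) ⊖ ((X ⊕ T) ⊕ P ⊖ (oneS ⊗ (B 1 ⊕ X) ⊖ R))
      ≈⟨ ⊖-difference (P ⊕ R) (≋-trans (sptPartial-recurrence 0 n) (⊕-congʳ (negS R) (⊗-congʳ (B 1 ⊕ X) qPow-zero))) ⟩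
    P ⊕ R                                         ∎
    where
    open ≋-Reasoning
    T = sptTerm 0 n
    X = sptPartial 0 n
    P = sptPartial 1 (suc n)
    R = qPow 1 ⊗ (B 1 ⊕ sptPartial 1 n)

record SptRecurrence (F : ℕ → Series) : Set where
  field
    base : F 1 ⊗ (oneS ⊕ qPow 1) ≋ B 2 ⊗ (oneS ⊕ qPow 1) ⊖ oneS
    step : ∀ k → F (2 ℕ.+ k) ⊗ (oneS ⊕ qPow (2 ℕ.+ k))
                   ≋ (qPow (suc k) ⊖ oneS) ⊗ F (suc k) ⊕ qPow (suc k) ⊗ (B 2 ⊗ (oneS ⊕ qPow 1))

SptRecurrence-unique : ∀ {F G} → SptRecurrence F → SptRecurrence G → ∀ k → F (suc k) ≋ G (suc k)
SptRecurrence-unique rF rG zero =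
  ⊗-cancelʳ (oneS ⊕ qPow 1) refl (≋-trans (SptRecurrence.base rF) (≋-sym (SptRecurrence.base rG)))
SptRecurrence-unique {F} {G} rF rG (suc k) = ⊗-cancelʳ (oneS ⊕ qPow (2 ℕ.+ k)) refl (begin
  F (2 ℕ.+ k) ⊗ (oneS ⊕ qPow (2 ℕ.+ k))       ≈⟨ SptRecurrence.step rF k ⟩
  (qPow (suc k) ⊖ oneS) ⊗ F (suc k) ⊕ X       ≈⟨ ⊕-congʳ X (⊗-congˡ (qPow (suc k) ⊖ oneS) (SptRecurrence-unique rF rG k)) ⟩
  (qPow (suc k) ⊖ oneS) ⊗ G (suc k) ⊕ X       ≈⟨ ≋-sym (SptRecurrence.step rG k) ⟩
  G (2 ℕ.+ k) ⊗ (oneS ⊕ qPow (2 ℕ.+ k))       ∎)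
  where
  open ≋-Reasoning
  X = qPow (suc k) ⊗ (B 2 ⊗ (oneS ⊕ qPow 1))

sptGF-recurrence : SptRecurrence sptGF
sptGF-recurrence = record { base = base ; step = step }
  where
  open ≋-Reasoning
  q = qPow 1
  B₂-step : B 2 ⊗ (oneS ⊕ q) ≋ B 1 ⊗ (oneS ⊖ q)
  B₂-step = ≋-sym (B-step 1 (s≤s z≤n))
  base : sptGF 1 ⊗ (oneS ⊕ q) ≋ B 2 ⊗ (oneS ⊕ q) ⊖ oneS
  base = begin
    S ⊗ (oneS ⊕ q)
      ≈⟨ solve 3 (λ s b q → s :* (con (+ 1) :+ q) := (b :* (con (+ 1) :- q) :- con (+ 1)) :- ((b :- con (+ 1)) :- (s :+ q :* (b :+ s)))) ≋-refl S (B 1) q ⟩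
    (B 1 ⊗ (oneS ⊖ q) ⊖ oneS) ⊖ ((B 1 ⊖ oneS) ⊖ (S ⊕ q ⊗ (B 1 ⊕ S)))
      ≈⟨ ⊖-difference (B 1 ⊗ (oneS ⊖ q) ⊖ oneS) sptGF-base ⟩
    B 1 ⊗ (oneS ⊖ q) ⊖ oneS
      ≈⟨ ⊕-congʳ (negS oneS) (≋-sym B₂-step) ⟩
    B 2 ⊗ (oneS ⊕ q) ⊖ oneS ∎
    where S = sptGF 1
  step : ∀ k → sptGF (2 ℕ.+ k) ⊗ (oneS ⊕ qPow (2 ℕ.+ k)) ≋ (qPow (suc k) ⊖ oneS) ⊗ sptGF (suc k) ⊕ qPow (suc k) ⊗ (B 2 ⊗ (oneS ⊕ q))
  step k = begin
    S′ ⊗ (oneS ⊕ qPow (2 ℕ.+ k))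
      ≈⟨ ⊗-congˡ S′ (⊕-congˡ oneS (qPow-+ 1 (suc k))) ⟩
    S′ ⊗ (oneS ⊕ q ⊗ Q)
      ≈⟨ solve 5 (λ s s′ b q Q → s′ :* (con (+ 1) :+ q :* Q)
                   := ((Q :- con (+ 1)) :* s :+ Q :* (b :* (con (+ 1) :- q))) :- ((Q :* (b :+ s) :- (q :* Q) :* (b :+ s′)) :- (s :+ s′)))
                 ≋-refl S S′ (B 1) q Q ⟩
    ((Q ⊖ oneS) ⊗ S ⊕ Q ⊗ (B 1 ⊗ (oneS ⊖ q))) ⊖ ((Q ⊗ (B 1 ⊕ S) ⊖ (q ⊗ Q) ⊗ (B 1 ⊕ S′)) ⊖ (S ⊕ S′))
      ≈⟨ ⊖-difference ((Q ⊖ oneS) ⊗ S ⊕ Q ⊗ (B 1 ⊗ (oneS ⊖ q)))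
           (≋-sym (≋-trans (sptGF-step k) (⊕-congˡ (Q ⊗ (B 1 ⊕ S)) (negS-cong (⊗-congʳ (B 1 ⊕ S′) (qPow-+ 1 (suc k))))))) ⟩
    (Q ⊖ oneS) ⊗ S ⊕ Q ⊗ (B 1 ⊗ (oneS ⊖ q))
      ≈⟨ ⊕-congˡ ((Q ⊖ oneS) ⊗ S) (⊗-congˡ Q (≋-sym B₂-step)) ⟩
    (Q ⊖ oneS) ⊗ S ⊕ Q ⊗ (B 2 ⊗ (oneS ⊕ q)) ∎
    where
    S = sptGF (suc k)
    S′ = sptGF (2 ℕ.+ k)
    Q = qPow (suc k)

-- The right-hand side

pochQuotient : ℕ → Series
pochQuotient k = poch (+ 1) 1 (k ∸ 1) ⊘ poch (- + 1) 1 k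

pochQuotient-one : pochQuotient 1 ⊗ (oneS ⊕ qPow 1) ≋ oneS
pochQuotient-one = begin
  pochQuotient 1 ⊗ (oneS ⊕ qPow 1)       ≈⟨ ⊗-congˡ (pochQuotient 1) (≋-sym (≋-trans (⊗-identityˡ _) (factor--1 1))) ⟩
  pochQuotient 1 ⊗ poch (- + 1) 1 1      ≈⟨ ⊘-⊗ oneS (poch (- + 1) 1 1) (poch-unit (- + 1) 1) ⟩
  oneS                                   ∎
  where open ≋-Reasoning

pochQuotient-step : ∀ k → pochQuotient (2 ℕ.+ k) ⊗ (oneS ⊕ qPow (2 ℕ.+ k)) ≋ pochQuotient (suc k) ⊗ (oneS ⊖ qPow (suc k))
pochQuotient-step k = ⊗-cancelʳ W (poch-unit (- + 1) (suc k)) (begin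
  (c′ ⊗ (oneS ⊕ qPow (2 ℕ.+ k))) ⊗ W      ≈⟨ solve 3 (λ c x w → (c :* x) :* w := c :* (w :* x)) ≋-refl c′ (oneS ⊕ qPow (2 ℕ.+ k)) W ⟩
  c′ ⊗ (W ⊗ (oneS ⊕ qPow (2 ℕ.+ k)))      ≈⟨ ⊗-congˡ c′ (⊗-congˡ W (≋-sym (factor--1 (2 ℕ.+ k)))) ⟩
  c′ ⊗ poch (- + 1) 1 (2 ℕ.+ k)           ≈⟨ ⊘-⊗ (poch (+ 1) 1 (suc k)) (poch (- + 1) 1 (2 ℕ.+ k)) (poch-unit (- + 1) (2 ℕ.+ k)) ⟩
  poch (+ 1) 1 k ⊗ factor (+ 1) (suc k)   ≈⟨ ⊗-cong (≋-sym (⊘-⊗ (poch (+ 1) 1 k) W (poch-unit (- + 1) (suc k)))) (factor-+1 (suc k)) ⟩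
  (c ⊗ W) ⊗ (oneS ⊖ qPow (suc k))         ≈⟨ solve 3 (λ c w x → (c :* w) :* x := (c :* x) :* w) ≋-refl c W (oneS ⊖ qPow (suc k)) ⟩
  (c ⊗ (oneS ⊖ qPow (suc k))) ⊗ W         ∎)
  where
  open ≋-Reasoning
  W = poch (- + 1) 1 (suc k)
  c = pochQuotient (suc k)
  c′ = pochQuotient (2 ℕ.+ k)

Pbar-step : ∀ k → Pbar (2 ℕ.+ k) ⊗ (oneS ⊕ qPow (2 ℕ.+ k)) ≋ (qPow (suc k) ⊖ oneS) ⊗ Pbar (suc k) ⊕ qPow (suc k) ⊗ (oneS ⊕ qPow 1)
Pbar-step k = ⊘-⊗ ((qPow (suc k) ⊖ oneS) ⊗ Pbar (suc k) ⊕ qPow (suc k) ⊗ (oneS ⊕ qPow 1)) (oneS ⊕ qPow (2 ℕ.+ k)) refl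

rhsSeries-recurrence : SptRecurrence rhsSeries
rhsSeries-recurrence = record { base = base ; step = step }
  where
  open ≋-Reasoning
  q = qPow 1
  base : rhsSeries 1 ⊗ (oneS ⊕ q) ≋ B 2 ⊗ (oneS ⊕ q) ⊖ oneS
  base = begin
    (oneS ⊗ B 2 ⊕ scale (- + 1) c) ⊗ (oneS ⊕ q)
      ≈⟨ ⊗-congʳ (oneS ⊕ q) (⊕-cong (⊗-identityˡ (B 2)) (mk≋ λ n → ℤₚ.-1*i≡-i (c n))) ⟩
    (B 2 ⊖ c) ⊗ (oneS ⊕ q)
      ≈⟨ solve 3 (λ b c q → (b :- c) :* (con (+ 1) :+ q) := b :* (con (+ 1) :+ q) :- c :* (con (+ 1) :+ q)) ≋-refl (B 2) c q ⟩
    B 2 ⊗ (oneS ⊕ q) ⊖ c ⊗ (oneS ⊕ q)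
      ≈⟨ ⊕-congˡ (B 2 ⊗ (oneS ⊕ q)) (negS-cong pochQuotient-one) ⟩
    B 2 ⊗ (oneS ⊕ q) ⊖ oneS ∎
    where c = pochQuotient 1
  step : ∀ k → rhsSeries (2 ℕ.+ k) ⊗ (oneS ⊕ qPow (2 ℕ.+ k)) ≋ (qPow (suc k) ⊖ oneS) ⊗ rhsSeries (suc k) ⊕ qPow (suc k) ⊗ (B 2 ⊗ (oneS ⊕ q))
  step k = begin
    (P′ ⊗ B 2 ⊕ scale (- σ) c′) ⊗ E′
      ≈⟨ ⊗-congʳ E′ (⊕-congˡ (P′ ⊗ B 2) (scale-neg σ c′)) ⟩
    (P′ ⊗ B 2 ⊖ scale σ c′) ⊗ E′
      ≈⟨ solve 4 (λ p b s e → (p :* b :- s) :* e := (p :* e) :* b :- s :* e) ≋-refl P′ (B 2) (scale σ c′) E′ ⟩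
    (P′ ⊗ E′) ⊗ B 2 ⊖ scale σ c′ ⊗ E′
      ≈⟨ ⊕-cong (⊗-congʳ (B 2) (Pbar-step k)) (negS-cong quotient-part) ⟩
    ((Q ⊖ oneS) ⊗ P ⊕ Q ⊗ (oneS ⊕ q)) ⊗ B 2 ⊖ scale σ c ⊗ (oneS ⊖ Q)
      ≈⟨ solve 5 (λ p b s Q q → ((Q :- con (+ 1)) :* p :+ Q :* (con (+ 1) :+ q)) :* b :- s :* (con (+ 1) :- Q)
                                 := (Q :- con (+ 1)) :* (p :* b :+ s) :+ Q :* (b :* (con (+ 1) :+ q))) ≋-refl P (B 2) (scale σ c) Q q ⟩
    (Q ⊖ oneS) ⊗ (P ⊗ B 2 ⊕ scale σ c) ⊕ Q ⊗ (B 2 ⊗ (oneS ⊕ q)) ∎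
    where
    σ = signPow (suc k)
    P = Pbar (suc k)
    P′ = Pbar (2 ℕ.+ k)
    c = pochQuotient (suc k)
    c′ = pochQuotient (2 ℕ.+ k)
    Q = qPow (suc k)
    E′ = oneS ⊕ qPow (2 ℕ.+ k)
    quotient-part : scale σ c′ ⊗ E′ ≋ scale σ c ⊗ (oneS ⊖ Q)
    quotient-part = begin
      scale σ c′ ⊗ E′          ≈⟨ scale-⊗ σ c′ E′ ⟩
      scale σ (c′ ⊗ E′)        ≈⟨ scale-cong σ (pochQuotient-step k) ⟩
      scale σ (c ⊗ (oneS ⊖ Q)) ≈⟨ ≋-sym (scale-⊗ σ c (oneS ⊖ Q)) ⟩
      scale σ c ⊗ (oneS ⊖ Q)   ∎

sptGF≋rhsSeries : ∀ k → sptGF (suc k) ≋ rhsSeries (suc k)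
sptGF≋rhsSeries = SptRecurrence-unique sptGF-recurrence rhsSeries-recurrence

-- Counting overpartitions

count : {A : Set} → (A → Bool) → List A → ℕ
count p xs = length (filterᵇ p xs)

count-cong : ∀ {A : Set} {p p′ : A → Bool} xs → (∀ x → p x ≡ p′ x) → count p xs ≡ count p′ xs
count-cong []       p≗p′ = refl
count-cong {p = p} {p′} (x ∷ xs) p≗p′ with p x | p′ x | p≗p′ x
... | true  | true  | refl = cong suc (count-cong xs p≗p′)
... | false | false | refl = count-cong xs p≗p′

count-++ : ∀ {A : Set} (p : A → Bool) xs ys → count p (xs ++ ys) ≡ count p xs ℕ.+ count p ys
count-++ p xs ys = trans (cong length (filter-++ (T? ∘ p) xs ys)) (length-++ (filterᵇ p xs))

count-false : ∀ {A : Set} (xs : List A) → count (λ _ → false) xs ≡ 0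
count-false []       = refl
count-false (x ∷ xs) = count-false xs

count-map : ∀ {A B : Set} (p : B → Bool) (f : A → B) xs → count p (map f xs) ≡ count (p ∘ f) xs
count-map p f []       = refl
count-map p f (x ∷ xs) with p (f x)
... | true  = cong suc (count-map p f xs)
... | false = count-map p f xs

genFun : {V : Set} → (V → Bool) → (V → ℕ) → List V → Series
genFun p wt vs w = + count (λ v → p v ∧ (wt v ≡ᵇ w)) vs

genFun-++ : ∀ {V : Set} p wt (xs ys : List V) → genFun p wt (xs ++ ys) ≋ genFun p wt xs ⊕ genFun p wt ys
genFun-++ p wt xs ys = mk≋ λ w → trans (cong +_ (count-++ _ xs ys)) (ℤₚ.pos-+ (count _ xs) (count _ ys))

genFun-map : ∀ {U V : Set} p wt (f : U → V) vs → genFun p wt (map f vs) ≋ genFun (p ∘ f) (wt ∘ f) vs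
genFun-map p wt f vs = mk≋ λ w → cong +_ (count-map _ f vs)

genFun-+ : ∀ {V : Set} p wt d (vs : List V) → genFun p (λ v → d ℕ.+ wt v) vs ≋ qPow d ⊗ genFun p wt vs
genFun-+ p wt d vs = ≋-trans (shifted d) (≋-sym (qPow-⊗ d (genFun p wt vs)))
  where
  shifted : ∀ d → genFun p (λ v → d ℕ.+ wt v) vs ≋ shift d (genFun p wt vs)
  shifted zero    = ≋-refl
  shifted (suc d) = mk≋ λ where
    zero    → cong +_ (trans (count-cong vs (λ v → ∧-zeroʳ (p v))) (count-false vs))
    (suc w) → at (shifted d) w

genFun-const : ∀ {V : Set} b wt (vs : List V) → genFun (λ _ → b) wt vs ≋ (if b then genFun (λ _ → true) wt vs else zeroS)
genFun-const true  wt vs = ≋-refl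
genFun-const false wt vs = mk≋ λ w → cong +_ (count-false vs)

genFun-cons : ∀ p j a b vs →
  genFun p (weightFrom j) (map ((a , b) ∷_) vs) ≋ qPow (j ℕ.* (a ℕ.+ bit b)) ⊗ genFun (p ∘ ((a , b) ∷_)) (weightFrom (suc j)) vs
genFun-cons p j a b vs =
  ≋-trans (genFun-map p (weightFrom j) ((a , b) ∷_) vs) (genFun-+ (p ∘ ((a , b) ∷_)) (weightFrom (suc j)) (j ℕ.* (a ℕ.+ bit b)) vs)

genFun-allLists : ∀ p M j len → genFun p (weightFrom j) (allLists M (suc len)) ≋
  ΣS (suc M) (λ a → qPow (j ℕ.* (a ℕ.+ 1)) ⊗ genFun (p ∘ ((a , true) ∷_)) (weightFrom (suc j)) (allLists M len)
                  ⊕ qPow (j ℕ.* (a ℕ.+ 0)) ⊗ genFun (p ∘ ((a , false) ∷_)) (weightFrom (suc j)) (allLists M len))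
genFun-allLists p M j len = over (λ a → a) (suc M)
  where
  L = allLists M len
  F : ℕ → Bool → Series
  F a b = qPow (j ℕ.* (a ℕ.+ bit b)) ⊗ genFun (p ∘ ((a , b) ∷_)) (weightFrom (suc j)) L
  over : ∀ f n → genFun p (weightFrom j) (concatMap (λ e → map (e ∷_) L) (cartesianProduct (applyUpTo f n) (true ∷ false ∷ [])))
                   ≋ ΣS n (λ a → F (f a) true ⊕ F (f a) false)
  over f zero    = ≋-refl
  over f (suc n) = begin
    genFun p (weightFrom j) (map ((f 0 , true) ∷_) L ++ (map ((f 0 , false) ∷_) L ++ rest))
      ≈⟨ ≋-trans (genFun-++ p (weightFrom j) (map ((f 0 , true) ∷_) L) _)
                 (⊕-congˡ (genFun p (weightFrom j) (map ((f 0 , true) ∷_) L)) (genFun-++ p (weightFrom j) (map ((f 0 , false) ∷_) L) rest)) ⟩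
    genFun p (weightFrom j) (map ((f 0 , true) ∷_) L) ⊕ (genFun p (weightFrom j) (map ((f 0 , false) ∷_) L) ⊕ genFun p (weightFrom j) rest)
      ≈⟨ ⊕-cong (genFun-cons p j (f 0) true L) (⊕-cong (genFun-cons p j (f 0) false L) (over (f ∘ suc) n)) ⟩
    F (f 0) true ⊕ (F (f 0) false ⊕ ΣS n (λ a → F (f (suc a)) true ⊕ F (f (suc a)) false))
      ≈⟨ ≋-trans (≋-sym (⊕-assoc (F (f 0) true) (F (f 0) false) _)) (≋-sym (ΣS-suc n (λ a → F (f a) true ⊕ F (f a) false))) ⟩
    ΣS (suc n) (λ a → F (f a) true ⊕ F (f a) false) ∎
    where
    open ≋-Reasoning
    rest = concatMap (λ e → map (e ∷_) L) (cartesianProduct (applyUpTo (f ∘ suc) n) (true ∷ false ∷ []))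

ΣS-B-blocks : ∀ j M → 1 ≤ j →
  ΣS M (λ a → qPow (j ℕ.* (a ℕ.+ 1)) ⊗ B (suc j) ⊕ qPow (j ℕ.* (a ℕ.+ 0)) ⊗ B (suc j)) ≋ B j ⊖ qPow (j ℕ.* M) ⊗ B j
ΣS-B-blocks j M 1≤j = begin
  ΣS M (λ a → qPow (j ℕ.* (a ℕ.+ 1)) ⊗ B (suc j) ⊕ qPow (j ℕ.* (a ℕ.+ 0)) ⊗ B (suc j))
    ≈⟨ ΣS-cong M block ⟩
  ΣS M (λ a → Y ⊗ qPow (j ℕ.* a))
    ≈⟨ ≋-sym (ΣS-⊗ M Y (λ a → qPow (j ℕ.* a))) ⟩
  Y ⊗ ΣS M (λ a → qPow (j ℕ.* a))
    ≈⟨ ≋-trans (⊗-assoc (B j) (oneS ⊖ qPow j) (ΣS M (λ a → qPow (j ℕ.* a)))) (⊗-congˡ (B j) (geometric-sum j M)) ⟩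
  B j ⊗ (oneS ⊖ qPow (j ℕ.* M))
    ≈⟨ solve 2 (λ b x → b :* (con (+ 1) :- x) := b :- x :* b) ≋-refl (B j) (qPow (j ℕ.* M)) ⟩
  B j ⊖ qPow (j ℕ.* M) ⊗ B j ∎
  where
  open ≋-Reasoning
  Y = B j ⊗ (oneS ⊖ qPow j)
  block : ∀ a → qPow (j ℕ.* (a ℕ.+ 1)) ⊗ B (suc j) ⊕ qPow (j ℕ.* (a ℕ.+ 0)) ⊗ B (suc j) ≋ Y ⊗ qPow (j ℕ.* a)
  block a = begin
    qPow (j ℕ.* (a ℕ.+ 1)) ⊗ B (suc j) ⊕ qPow (j ℕ.* (a ℕ.+ 0)) ⊗ B (suc j)
      ≈⟨ ⊕-cong (⊗-congʳ (B (suc j)) (≋-trans (qPow-cong (ℕₚ.*-distribˡ-+ j a 1)) (≋-trans (qPow-+ (j ℕ.* a) (j ℕ.* 1))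
                                                (⊗-congˡ (qPow (j ℕ.* a)) (qPow-cong (ℕₚ.*-identityʳ j))))))
                (⊗-congʳ (B (suc j)) (qPow-cong (cong (j ℕ.*_) (ℕₚ.+-identityʳ a)))) ⟩
    (qPow (j ℕ.* a) ⊗ qPow j) ⊗ B (suc j) ⊕ qPow (j ℕ.* a) ⊗ B (suc j)
      ≈⟨ solve 3 (λ Q x b → (Q :* x) :* b :+ Q :* b := (b :* (con (+ 1) :+ x)) :* Q) ≋-refl (qPow (j ℕ.* a)) (qPow j) (B (suc j)) ⟩
    (B (suc j) ⊗ (oneS ⊕ qPow j)) ⊗ qPow (j ℕ.* a)
      ≈⟨ ⊗-congʳ (qPow (j ℕ.* a)) (≋-sym (B-step j 1≤j)) ⟩
    Y ⊗ qPow (j ℕ.* a) ∎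

genFun-allLists-B : ∀ M j len {m} → 1 ≤ j → m ≤ suc M → m ≤ j ℕ.+ len →
  genFun (λ _ → true) (weightFrom j) (allLists M len) ≈[< m ] B j
genFun-allLists-B M j zero    1≤j m≤1+M m≤j+0 zero    _   = sym (B-below j 0 1≤j)
genFun-allLists-B M j zero    1≤j m≤1+M m≤j+0 (suc w) w<m =
  sym (B-below j (suc w) (ℕₚ.<-≤-trans w<m (subst (_ ≤_) (ℕₚ.+-identityʳ j) m≤j+0)))
genFun-allLists-B M j (suc len) {m} 1≤j m≤1+M m≤j+1+len = begin
  genFun (λ _ → true) (weightFrom j) (allLists M (suc len))
    ≈⟨ ≋⇒≈[<] (genFun-allLists (λ _ → true) M j len) ⟩
  ΣS (suc M) (λ a → qPow (j ℕ.* (a ℕ.+ 1)) ⊗ G ⊕ qPow (j ℕ.* (a ℕ.+ 0)) ⊗ G)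
    ≈⟨ ΣS-cong-below (suc M) (λ a → ⊕-cong-below (⊗-congˡ-below (qPow (j ℕ.* (a ℕ.+ 1))) IH) (⊗-congˡ-below (qPow (j ℕ.* (a ℕ.+ 0))) IH)) ⟩
  ΣS (suc M) (λ a → qPow (j ℕ.* (a ℕ.+ 1)) ⊗ B (suc j) ⊕ qPow (j ℕ.* (a ℕ.+ 0)) ⊗ B (suc j))
    ≈⟨ ≋⇒≈[<] (ΣS-B-blocks j (suc M) 1≤j) ⟩
  B j ⊖ qPow (j ℕ.* suc M) ⊗ B j
    ≈⟨ (λ i i<m → trans (cong (λ x → B j i - x) (qPow-⊗-≈[<]-zero (j ℕ.* suc M) (B j) m≤j*[1+M] i i<m)) (ℤₚ.+-identityʳ (B j i))) ⟩
  B j ∎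
  where
  open ≈[<]-Reasoning m
  G = genFun (λ _ → true) (weightFrom (suc j)) (allLists M len)
  IH : G ≈[< m ] B (suc j)
  IH = genFun-allLists-B M (suc j) len (s≤s z≤n) m≤1+M (subst (m ≤_) (ℕₚ.+-suc j len) m≤j+1+len)
  m≤j*[1+M] : m ≤ j ℕ.* suc M
  m≤j*[1+M] = ℕₚ.≤-trans m≤1+M (ℕₚ.m≤n*m (suc M) j {{ℕ.>-nonZero 1≤j}})

module _ {k : ℕ} (F : ℕ → Bool → Series) (F-false : ∀ a → F a false ≋ zeroS) where

  private
    F-off : ∀ a → a ≢ k → F a (a ≡ᵇ k) ≋ zeroS
    F-off a a≢k = subst (λ b → F a b ≋ zeroS) (sym (dec-false (a ℕ.≟ k) a≢k)) (F-false a)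

  ΣS-indicator-≥ : ∀ {M} → M ≤ k → ΣS M (λ a → F a (a ≡ᵇ k)) ≋ zeroS
  ΣS-indicator-≥ {zero}  _     = ≋-refl
  ΣS-indicator-≥ {suc M} 1+M≤k = ⊕-cong (ΣS-indicator-≥ (ℕₚ.<⇒≤ 1+M≤k)) (F-off M (ℕₚ.<⇒≢ 1+M≤k))

  ΣS-indicator-< : ∀ {M} → k < M → ΣS M (λ a → F a (a ≡ᵇ k)) ≋ F k true
  ΣS-indicator-< {suc M} (s≤s k≤M) with ℕₚ.m≤n⇒m<n∨m≡n k≤M
  ... | inj₁ k<M  = ≋-trans (⊕-cong (ΣS-indicator-< k<M) (F-off M (ℕₚ.>⇒≢ k<M))) (⊕-identityʳ (F k true))
  ... | inj₂ refl = ≋-trans (⊕-cong (ΣS-indicator-≥ ℕₚ.≤-refl) (subst (λ b → F k b ≋ F k true) (sym (dec-true (k ℕ.≟ k) refl)) ≋-refl))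
                            (⊕-identityˡ (F k true))

genFun-spt-step : ∀ M k j len → genFun (sptCond (suc k)) (weightFrom j) (allLists M (suc len)) ≋
  genFun (sptCond (suc k)) (weightFrom (suc j)) (allLists M len)
    ⊕ ΣS M (λ a → qPow (j ℕ.* (suc a ℕ.+ 0)) ⊗ genFun (λ _ → a ≡ᵇ k) (weightFrom (suc j)) (allLists M len))
genFun-spt-step M k j len = begin
  genFun (sptCond (suc k)) (weightFrom j) (allLists M (suc len))
    ≈⟨ ≋-trans (genFun-allLists (sptCond (suc k)) M j len) (ΣS-suc M _) ⟩
  (qPow (j ℕ.* 1) ⊗ none ⊕ qPow (j ℕ.* 0) ⊗ X) ⊕ ΣS M (λ a → qPow (j ℕ.* (suc a ℕ.+ 1)) ⊗ none ⊕ F a)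
    ≈⟨ ⊕-cong (⊕-cong (vanish (qPow (j ℕ.* 1))) (≋-trans (⊗-congʳ X (≋-trans (qPow-cong (ℕₚ.*-zeroʳ j)) qPow-zero)) (⊗-identityˡ X)))
              (ΣS-cong M (λ a → ≋-trans (⊕-congʳ (F a) (vanish (qPow (j ℕ.* (suc a ℕ.+ 1))))) (⊕-identityˡ (F a)))) ⟩
  (zeroS ⊕ X) ⊕ ΣS M F
    ≈⟨ ⊕-congʳ (ΣS M F) (⊕-identityˡ X) ⟩
  X ⊕ ΣS M F ∎
  where
  open ≋-Reasoning
  L = allLists M len
  none = genFun (λ _ → false) (weightFrom (suc j)) L
  X = genFun (sptCond (suc k)) (weightFrom (suc j)) L
  F : ℕ → Series
  F a = qPow (j ℕ.* (suc a ℕ.+ 0)) ⊗ genFun (λ _ → a ≡ᵇ k) (weightFrom (suc j)) L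
  vanish : ∀ h → h ⊗ none ≋ zeroS
  vanish h = ≋-trans (⊗-congˡ h (genFun-const false (weightFrom (suc j)) L)) (⊗-zeroʳ h)

smallest-part : ∀ M k j len {m} → 1 ≤ j → m ≤ suc M → m ≤ suc j ℕ.+ len →
  ΣS M (λ a → qPow (j ℕ.* (suc a ℕ.+ 0)) ⊗ genFun (λ _ → a ≡ᵇ k) (weightFrom (suc j)) (allLists M len))
    ≈[< m ] qPow (suc k ℕ.* j) ⊗ B (suc j)
smallest-part M k j len {m} 1≤j m≤1+M m≤1+j+len = [ present , absent ]′ (ℕₚ.<-≤-connex k M)
  where
  open ≈[<]-Reasoning m
  L = allLists M len
  F : ℕ → Bool → Series
  F a b = qPow (j ℕ.* (suc a ℕ.+ 0)) ⊗ genFun (λ _ → b) (weightFrom (suc j)) L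
  F-false : ∀ a → F a false ≋ zeroS
  F-false a = ≋-trans (⊗-congˡ (qPow (j ℕ.* (suc a ℕ.+ 0))) (genFun-const false (weightFrom (suc j)) L)) (⊗-zeroʳ (qPow (j ℕ.* (suc a ℕ.+ 0))))
  present : k < M → ΣS M (λ a → F a (a ≡ᵇ k)) ≈[< m ] qPow (suc k ℕ.* j) ⊗ B (suc j)
  present k<M = begin
    ΣS M (λ a → F a (a ≡ᵇ k))
      ≈⟨ ≋⇒≈[<] (ΣS-indicator-< F F-false k<M) ⟩
    qPow (j ℕ.* (suc k ℕ.+ 0)) ⊗ genFun (λ _ → true) (weightFrom (suc j)) L
      ≈⟨ ⊗-congˡ-below (qPow (j ℕ.* (suc k ℕ.+ 0))) (genFun-allLists-B M (suc j) len (s≤s z≤n) m≤1+M m≤1+j+len) ⟩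
    qPow (j ℕ.* (suc k ℕ.+ 0)) ⊗ B (suc j)
      ≈⟨ ≋⇒≈[<] (⊗-congʳ (B (suc j)) (qPow-cong (trans (cong (j ℕ.*_) (ℕₚ.+-identityʳ (suc k))) (ℕₚ.*-comm j (suc k))))) ⟩
    qPow (suc k ℕ.* j) ⊗ B (suc j) ∎
  absent : M ≤ k → ΣS M (λ a → F a (a ≡ᵇ k)) ≈[< m ] qPow (suc k ℕ.* j) ⊗ B (suc j)
  absent M≤k = begin
    ΣS M (λ a → F a (a ≡ᵇ k))         ≈⟨ ≋⇒≈[<] (ΣS-indicator-≥ F F-false M≤k) ⟩
    zeroS                             ≈⟨ qPow-⊗-≈[<]-zero (suc k ℕ.* j) (B (suc j)) m≤k*j ⟨
    qPow (suc k ℕ.* j) ⊗ B (suc j)    ∎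
    where
    m≤k*j : m ≤ suc k ℕ.* j
    m≤k*j = ℕₚ.≤-trans m≤1+M (ℕₚ.≤-trans (s≤s M≤k) (ℕₚ.m≤m*n (suc k) j {{ℕ.>-nonZero 1≤j}}))

genFun-allLists-spt : ∀ M k j len {m} → 1 ≤ j → m ≤ suc M → m ≤ j ℕ.+ len →
  genFun (sptCond (suc k)) (weightFrom j) (allLists M len) ≈[< m ] ΣS len (λ s → qPow (suc k ℕ.* (j ℕ.+ s)) ⊗ B (suc (j ℕ.+ s)))
genFun-allLists-spt M k j zero      _   _     _          = λ _ _ → refl
genFun-allLists-spt M k j (suc len) {m} 1≤j m≤1+M m≤j+1+len = begin
  genFun (sptCond (suc k)) (weightFrom j) (allLists M (suc len))
    ≈⟨ ≋⇒≈[<] (genFun-spt-step M k j len) ⟩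
  genFun (sptCond (suc k)) (weightFrom (suc j)) (allLists M len)
    ⊕ ΣS M (λ a → qPow (j ℕ.* (suc a ℕ.+ 0)) ⊗ genFun (λ _ → a ≡ᵇ k) (weightFrom (suc j)) (allLists M len))
    ≈⟨ ⊕-cong-below (genFun-allLists-spt M k (suc j) len (s≤s z≤n) m≤1+M m≤1+j+len) (smallest-part M k j len 1≤j m≤1+M m≤1+j+len) ⟩
  ΣS len (T ∘ (suc j ℕ.+_)) ⊕ T j
    ≈⟨ ≋⇒≈[<] (⊕-comm (ΣS len (T ∘ (suc j ℕ.+_))) (T j)) ⟩
  T j ⊕ ΣS len (T ∘ (suc j ℕ.+_))
    ≈⟨ ≋⇒≈[<] (⊕-cong (T-cong (sym (ℕₚ.+-identityʳ j))) (ΣS-cong len (λ s → T-cong (sym (ℕₚ.+-suc j s))))) ⟩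
  T (j ℕ.+ 0) ⊕ ΣS len (T ∘ (j ℕ.+_) ∘ suc)
    ≈⟨ ≋⇒≈[<] (≋-sym (ΣS-suc len (T ∘ (j ℕ.+_)))) ⟩
  ΣS (suc len) (T ∘ (j ℕ.+_)) ∎
  where
  open ≈[<]-Reasoning m
  m≤1+j+len : m ≤ suc j ℕ.+ len
  m≤1+j+len = subst (m ≤_) (ℕₚ.+-suc j len) m≤j+1+len
  T : ℕ → Series
  T t = qPow (suc k ℕ.* t) ⊗ B (suc t)
  T-cong : ∀ {t u} → t ≡ u → T t ≋ T u
  T-cong t≡u = mk≋ λ n → cong (λ t → T t n) t≡u

sptSeries≡sptGF : ∀ k n → sptSeries (suc k) n ≡ sptGF (suc k) n
sptSeries≡sptGF k zero    = refl
sptSeries≡sptGF k (suc n) = trans (cong +_ (count-cong (allLists (suc n) (suc n)) (λ v → ∧-comm (weight v ≡ᵇ suc n) (sptCond (suc k) v))))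
  (genFun-allLists-spt (suc n) k 1 (suc n) (s≤s z≤n) ℕₚ.≤-refl ℕₚ.≤-refl (suc n) ℕₚ.≤-refl)

theorem2p1 : (k : ℕ) → 1 ≤ k → (n : ℕ) → sptSeries k n ≡ rhsSeries k n
theorem2p1 (suc k) _ n = trans (sptSeries≡sptGF k n) (at (sptGF≋rhsSeries k) n)
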